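{- Let $\mathbf B$ be a Boolean-pointed Brouwerian algebra with constant $0$, and write $\neg a:=a\to 0$. Then $\neg a\to a=a$ for all $a\in B$.
   Context: A Brouwerian algebra is a distributive lattice with top element $1$ equipped with a binary operation $\to$ of relative pseudocomplementation: $c\le a\to b\iff c\wedge a\le b$. It is Boolean-pointed if it has a constant $0$ such that the interval $[0,1]$ is a Boolean lattice (equivalently, $\neg\neg x=x\vee 0$ for all $x$, where $\neg x=x\to 0$). -}

module Defs where

open import Level using (Level; suc; _⊔_)
open import Data.Product using (Σ; _×_)
open import Algebra.Core using (Op₂)
open import Relation.Binary.Lattice using (DistributiveLattice; Exponential)
open import Relation.Binary.Definitions using (Maximum)

record BrouwerianAlgebra (c ℓ₁ ℓ₂ : Level) : Set (suc (c ⊔ ℓ₁ ⊔ ℓ₂)) where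
  field
    distributiveLattice : DistributiveLattice c ℓ₁ ℓ₂
  open DistributiveLattice distributiveLattice public
  infixr 5 _⇒_
  field
    ⊤           : Carrier
    maximum     : Maximum _≤_ ⊤
    _⇒_         : Op₂ Carrier
    exponential : Exponential _≤_ _∧_ _⇒_

-- The interval [z, ⊤] is a Boolean lattice: it is a sublattice of a
-- distributive lattice (hence distributive, bounded by z and ⊤), and every
-- element of it has a complement within it.
IntervalBoolean : ∀ {c ℓ₁ ℓ₂} (B : BrouwerianAlgebra c ℓ₁ ℓ₂) →
                  BrouwerianAlgebra.Carrier B → Set (c ⊔ ℓ₁ ⊔ ℓ₂)
IntervalBoolean B z =
  ∀ x → z ≤ x → Σ Carrier λ y → z ≤ y × (x ∧ y ≈ z) × (x ∨ y ≈ ⊤)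
  where open BrouwerianAlgebra B

record BooleanPointedBrouwerianAlgebra (c ℓ₁ ℓ₂ : Level) : Set (suc (c ⊔ ℓ₁ ⊔ ℓ₂)) where
  field
    brouwerianAlgebra : BrouwerianAlgebra c ℓ₁ ℓ₂
  open BrouwerianAlgebra brouwerianAlgebra public
  field
    𝟘               : Carrier
    intervalBoolean : IntervalBoolean brouwerianAlgebra 𝟘

  ¬_ : Carrier → Carrier
  ¬ a = a ⇒ 𝟘

{-# OPTIONS --safe #-}
-- The complement of a ∨ 0 in [0, 1] lies below ¬ a, so excluded middle
-- a ∨ ¬ a = 1 holds. In any Brouwerian algebra, x ∨ y = 1 forces y → x ≤ x:
-- meet y → x with x ∨ y and distribute. With y = ¬ a this gives ¬ a → a ≤ a.
module Submission where

open import Defs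
open import Data.Product using (_,_)
import Relation.Binary.Reasoning.PartialOrder as ≤-Reasoning

module BrouwerianAlgebraProperties {c ℓ₁ ℓ₂} (B : BrouwerianAlgebra c ℓ₁ ℓ₂) where
  open BrouwerianAlgebra B
  open ≤-Reasoning poset

  transpose-⇒ : ∀ {w x y} → w ∧ x ≤ y → w ≤ x ⇒ y
  transpose-⇒ {w} {x} {y} = let pf , _ = exponential w x y in pf

  transpose-∧ : ∀ {w x y} → w ≤ x ⇒ y → w ∧ x ≤ y
  transpose-∧ {w} {x} {y} = let _ , pf = exponential w x y in pf

  ⇒-eval : ∀ {x y} → (x ⇒ y) ∧ x ≤ y
  ⇒-eval = transpose-∧ refl

  y≤x⇒y : ∀ {x y} → y ≤ x ⇒ y
  y≤x⇒y {x} {y} = transpose-⇒ (x∧y≤x y x)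

  ⊤≤⇒≈⊤ : ∀ {x} → ⊤ ≤ x → x ≈ ⊤
  ⊤≤⇒≈⊤ {x} ⊤≤x = antisym (maximum x) ⊤≤x

  x∨y≈⊤⇒y⇒x≤x : ∀ {x y} → x ∨ y ≈ ⊤ → y ⇒ x ≤ x
  x∨y≈⊤⇒y⇒x≤x {x} {y} x∨y≈⊤ = begin
    y ⇒ x                           ≤⟨ ∧-greatest refl (trans (maximum _) (reflexive (Eq.sym x∨y≈⊤))) ⟩
    (y ⇒ x) ∧ (x ∨ y)               ≈⟨ ∧-distribˡ-∨ (y ⇒ x) x y ⟩
    ((y ⇒ x) ∧ x) ∨ ((y ⇒ x) ∧ y)   ≤⟨ ∨-least (x∧y≤y _ _) ⇒-eval ⟩
    x                               ∎

module BooleanPointedBrouwerianAlgebraProperties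
  {c ℓ₁ ℓ₂} (B : BooleanPointedBrouwerianAlgebra c ℓ₁ ℓ₂) where
  open BooleanPointedBrouwerianAlgebra B
  open BrouwerianAlgebraProperties brouwerianAlgebra
  open ≤-Reasoning poset

  𝟘≤¬x : ∀ {x} → 𝟘 ≤ ¬ x
  𝟘≤¬x = y≤x⇒y

  x∨¬x≈⊤ : ∀ x → x ∨ ¬ x ≈ ⊤
  x∨¬x≈⊤ x with intervalBoolean (x ∨ 𝟘) (y≤x∨y x 𝟘)
  ... | y , _ , x∨𝟘∧y≈𝟘 , x∨𝟘∨y≈⊤ = ⊤≤⇒≈⊤ (begin
    ⊤              ≈⟨ Eq.sym x∨𝟘∨y≈⊤ ⟩
    (x ∨ 𝟘) ∨ y    ≤⟨ ∨-least (∨-least (x≤x∨y x (¬ x)) (trans 𝟘≤¬x (y≤x∨y x (¬ x))))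
                               (trans y≤¬x (y≤x∨y x (¬ x))) ⟩
    x ∨ ¬ x        ∎)
    where
    y≤¬x : y ≤ ¬ x
    y≤¬x = transpose-⇒ (begin
      y ∧ x          ≤⟨ ∧-greatest (trans (x∧y≤y y x) (x≤x∨y x 𝟘)) (x∧y≤x y x) ⟩
      (x ∨ 𝟘) ∧ y    ≈⟨ x∨𝟘∧y≈𝟘 ⟩
      𝟘              ∎)

  ¬x⇒x≈x : ∀ x → (¬ x) ⇒ x ≈ x
  ¬x⇒x≈x x = antisym (x∨y≈⊤⇒y⇒x≤x (x∨¬x≈⊤ x)) y≤x⇒y

mainTheorem16 : ∀ {c ℓ₁ ℓ₂} (B : BooleanPointedBrouwerianAlgebra c ℓ₁ ℓ₂) →
    let open BooleanPointedBrouwerianAlgebra B in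
      ∀ a → ((¬ a) ⇒ a) ≈ a
mainTheorem16 B = BooleanPointedBrouwerianAlgebraProperties.¬x⇒x≈x B
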